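{- If there is a (tree-like) $\mathbf{ND}_{\text{Ł}_3}$ proof of a formula $D$ in $n$ steps, then there is an Ł$_{3_{n\vee}}$ proof of $\Rightarrow D$ in $O(n)$ steps.
   Context: Formulas are built from variables with $\wedge,\vee,\supset,\neg$. $\mathbf{ND}_{\text{Ł}_3}$ (Tamminga's natural deduction for 3-valued Łukasiewicz logic): derivations are trees; a single assumption $A$, or a single axiom $(A\vee\neg A)\vee((B\vee\neg B)\vee(A\supset B))$, is a derivation, and derivations are extended by the rules: EFQ: from $A$ and $\neg A$ infer $B$; $\wedge I$: from $A$, $B$ infer $A\wedge B$; $\wedge E$: from $A\wedge B$ infer $A$, resp. $B$; $\vee I$: from $A$ (resp. $B$) infer $A\vee B$; $\vee E$: from $A\vee B$, a derivation of $C$ from assumption $[A]$ and a derivation of $C$ from assumption $[B]$ infer $C$, discharging those assumptions; DN: $A$ and $\neg\neg A$ interderivable; DeM$_\vee$: $\neg(A\vee B)$ and $\neg A\wedge\neg B$ interderivable; DeM$_\wedge$: $\neg(A\wedge B)$ and $\neg A\vee\neg B$ interderivable; $\supset_1$: from $\neg A\wedge\neg B$ infer $A\supset B$; $\supset_2$: from $\neg A$ infer $(B\vee\neg B)\vee(A\supset B)$; $\supset_3$: from $\neg A\wedge B$ infer $A\supset B$; $\supset_4$: from $\neg B$ and $(A\supset B)\vee\neg(A\supset B)$ infer $A\vee\neg A$; $\supset_5$: from $B$ infer $(A\vee\neg A)\vee(A\supset B)$; $\supset_6$: from $A\wedge\neg B$ infer $\neg(A\supset B)$; $\supset_7$: from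 $A$ and $(A\supset B)\vee\neg(A\supset B)$ infer $B\vee\neg B$; $\supset_8$: from $A\wedge B$ infer $A\supset B$. A proof of $D$ is a tree with root $D$ and all assumptions discharged; steps = nodes. $\mathcal{H}\text{Łuk}$ axiom schemas: (1) $A\supset(B\supset A)$; (2) $(A\supset B)\supset((B\supset C)\supset(A\supset C))$; (3) $((A\supset B)\supset B)\supset((B\supset A)\supset A)$; (4) $((((A\supset B)\supset A)\supset A)\supset(B\supset C))\supset(B\supset C)$; (5) $(A\wedge B)\supset A$; (6) $(A\wedge B)\supset B$; (7) $(A\supset B)\supset((A\supset C)\supset(A\supset(B\wedge C)))$; (8) $A\supset(A\vee B)$; (9) $B\supset(A\vee B)$; (10) $(A\supset C)\supset((B\supset C)\supset((A\vee B)\supset C))$; (11) $(\neg B\supset\neg A)\supset(A\supset B)$. Ł$_{3_{n\vee}}$: a proof is a sequence of lines, each a formula with a context (finite sequence of open assumptions, initially empty); a line is available to a later one if its context is an initial subsequence of the later one's and it lies in no closed block; lines are: $\mathcal{H}\text{Łuk}$ axiom instances; opening an assumption $A$ (context $\Gamma*\langle A\rangle$, $\Gamma$ the context of the last available line); modus ponens from available lines; $\vee_{ne}$: from available $A\vee B$ in context $\Gamma$, a block opened by $A$ ending in $C$ and a block opened by $B$ ending in $C$, close both blocks (their lines become unavailable) and write $C$ in context $\Gamma$. A proof of $\Rightarrow D$ ends with $D$ in empty context; steps = lines. -}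

module Defs where

open import Data.Nat using (ℕ; suc; _+_)
open import Data.List using (List; []; _∷_)
open import Data.List.Membership.Propositional using (_∈_)

infixr 40 ¬_
infixl 35 _∧_
infixl 30 _∨_
infixr 25 _⊃_

data Fm : Set where
  var : ℕ → Fm
  _∧_ : Fm → Fm → Fm
  _∨_ : Fm → Fm → Fm
  _⊃_ : Fm → Fm → Fm
  ¬_  : Fm → Fm

-- ND_Ł3 (Tamminga).  ND Γ C : a tree-like derivation of C whose open
-- (undischarged) assumptions are among Γ.  ∨E discharges the
-- assumptions A resp. B by moving them into the context.

data ND (Γ : List Fm) : Fm → Set where
  hyp   : ∀ {A} → A ∈ Γ → ND Γ A
  axm   : ∀ A B → ND Γ ((A ∨ ¬ A) ∨ ((B ∨ ¬ B) ∨ (A ⊃ B)))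
  efq   : ∀ {A} B → ND Γ A → ND Γ (¬ A) → ND Γ B
  ∧I    : ∀ {A B} → ND Γ A → ND Γ B → ND Γ (A ∧ B)
  ∧E₁   : ∀ {A B} → ND Γ (A ∧ B) → ND Γ A
  ∧E₂   : ∀ {A B} → ND Γ (A ∧ B) → ND Γ B
  ∨I₁   : ∀ {A} B → ND Γ A → ND Γ (A ∨ B)
  ∨I₂   : ∀ A {B} → ND Γ B → ND Γ (A ∨ B)
  ∨E    : ∀ {A B C} → ND Γ (A ∨ B) → ND (A ∷ Γ) C → ND (B ∷ Γ) C → ND Γ C
  dnI   : ∀ {A} → ND Γ A → ND Γ (¬ ¬ A)
  dnE   : ∀ {A} → ND Γ (¬ ¬ A) → ND Γ A
  deM∨₁ : ∀ {A B} → ND Γ (¬ (A ∨ B)) → ND Γ (¬ A ∧ ¬ B)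
  deM∨₂ : ∀ {A B} → ND Γ (¬ A ∧ ¬ B) → ND Γ (¬ (A ∨ B))
  deM∧₁ : ∀ {A B} → ND Γ (¬ (A ∧ B)) → ND Γ (¬ A ∨ ¬ B)
  deM∧₂ : ∀ {A B} → ND Γ (¬ A ∨ ¬ B) → ND Γ (¬ (A ∧ B))
  ⊃₁    : ∀ {A B} → ND Γ (¬ A ∧ ¬ B) → ND Γ (A ⊃ B)
  ⊃₂    : ∀ {A} B → ND Γ (¬ A) → ND Γ ((B ∨ ¬ B) ∨ (A ⊃ B))
  ⊃₃    : ∀ {A B} → ND Γ (¬ A ∧ B) → ND Γ (A ⊃ B)
  ⊃₄    : ∀ {A B} → ND Γ (¬ B) → ND Γ ((A ⊃ B) ∨ ¬ (A ⊃ B)) → ND Γ (A ∨ ¬ A)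
  ⊃₅    : ∀ A {B} → ND Γ B → ND Γ ((A ∨ ¬ A) ∨ (A ⊃ B))
  ⊃₆    : ∀ {A B} → ND Γ (A ∧ ¬ B) → ND Γ (¬ (A ⊃ B))
  ⊃₇    : ∀ {A B} → ND Γ A → ND Γ ((A ⊃ B) ∨ ¬ (A ⊃ B)) → ND Γ (B ∨ ¬ B)
  ⊃₈    : ∀ {A B} → ND Γ (A ∧ B) → ND Γ (A ⊃ B)

-- number of steps = number of nodes of the tree
ndSize : ∀ {Γ C} → ND Γ C → ℕ
ndSize (hyp _)       = 1
ndSize (axm _ _)     = 1
ndSize (efq _ p q)   = suc (ndSize p + ndSize q)
ndSize (∧I p q)      = suc (ndSize p + ndSize q)
ndSize (∧E₁ p)       = suc (ndSize p)
ndSize (∧E₂ p)       = suc (ndSize p)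
ndSize (∨I₁ _ p)     = suc (ndSize p)
ndSize (∨I₂ _ p)     = suc (ndSize p)
ndSize (∨E p q r)    = suc (ndSize p + ndSize q + ndSize r)
ndSize (dnI p)       = suc (ndSize p)
ndSize (dnE p)       = suc (ndSize p)
ndSize (deM∨₁ p)     = suc (ndSize p)
ndSize (deM∨₂ p)     = suc (ndSize p)
ndSize (deM∧₁ p)     = suc (ndSize p)
ndSize (deM∧₂ p)     = suc (ndSize p)
ndSize (⊃₁ p)        = suc (ndSize p)
ndSize (⊃₂ _ p)      = suc (ndSize p)
ndSize (⊃₃ p)        = suc (ndSize p)
ndSize (⊃₄ p q)      = suc (ndSize p + ndSize q)
ndSize (⊃₅ _ p)      = suc (ndSize p)
ndSize (⊃₆ p)        = suc (ndSize p)
ndSize (⊃₇ p q)      = suc (ndSize p + ndSize q)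
ndSize (⊃₈ p)        = suc (ndSize p)

NDProof : Fm → Set
NDProof D = ND [] D

data HŁuk : Fm → Set where
  ax1  : ∀ A B → HŁuk (A ⊃ (B ⊃ A))
  ax2  : ∀ A B C → HŁuk ((A ⊃ B) ⊃ ((B ⊃ C) ⊃ (A ⊃ C)))
  ax3  : ∀ A B → HŁuk (((A ⊃ B) ⊃ B) ⊃ ((B ⊃ A) ⊃ A))
  ax4  : ∀ A B C → HŁuk (((((A ⊃ B) ⊃ A) ⊃ A) ⊃ (B ⊃ C)) ⊃ (B ⊃ C))
  ax5  : ∀ A B → HŁuk ((A ∧ B) ⊃ A)
  ax6  : ∀ A B → HŁuk ((A ∧ B) ⊃ B)
  ax7  : ∀ A B C → HŁuk ((A ⊃ B) ⊃ ((A ⊃ C) ⊃ (A ⊃ (B ∧ C))))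
  ax8  : ∀ A B → HŁuk (A ⊃ (A ∨ B))
  ax9  : ∀ A B → HŁuk (B ⊃ (A ∨ B))
  ax10 : ∀ A B C → HŁuk ((A ⊃ C) ⊃ ((B ⊃ C) ⊃ ((A ∨ B) ⊃ C)))
  ax11 : ∀ A B → HŁuk ((¬ B ⊃ ¬ A) ⊃ (A ⊃ B))

-- Lines Δ Δ' : a consecutive run of lines written at one
-- context level.  Δ is the list of formulas of the lines available
-- when the run starts (most recent first), Δ' the list available when
-- it ends.  A block opened by assumption A (inside a run whose
-- available list is Δ) is the opening line followed by a run
-- Lines (A ∷ Δ) (C ∷ Θ), i.e. the block ends with C (C = A if the block
-- consists of the opening line only).  Closing the two blocks by ∨ne
-- discards their lines from the available list.

data Lines (Δ : List Fm) : List Fm → Set where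
  start : Lines Δ Δ
  axL   : ∀ {Δ' φ} → Lines Δ Δ' → HŁuk φ → Lines Δ (φ ∷ Δ')
  mpL   : ∀ {Δ' A B} → Lines Δ Δ' → A ∈ Δ' → (A ⊃ B) ∈ Δ' → Lines Δ (B ∷ Δ')
  ∨neL  : ∀ {Δ' A B C Θ₁ Θ₂} → Lines Δ Δ' → (A ∨ B) ∈ Δ' →
          Lines (A ∷ Δ') (C ∷ Θ₁) →
          Lines (B ∷ Δ') (C ∷ Θ₂) →
          Lines Δ (C ∷ Δ')

-- number of lines (assumption-opening lines count one each)
lines# : ∀ {Δ Δ'} → Lines Δ Δ' → ℕ
lines# start            = 0
lines# (axL p _)        = suc (lines# p)
lines# (mpL p _ _)      = suc (lines# p)
lines# (∨neL p _ q r)   = suc (lines# p + suc (lines# q) + suc (lines# r))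

ŁProof : Fm → Set
ŁProof D = Σ (List Fm) (λ Θ → Lines [] (D ∷ Θ))
  where open import Data.Product using (Σ)

-- Each ND rule becomes a fixed Hilbert-style derivation of its conclusion from its premises,
-- applied by cut rather than by modus ponens, since the rules are not all valid implications
-- (⊃₆ uses its premise twice, and contraction fails in Ł3).  The ND axiom needs the three-valued
-- law ((A ⊃ ¬ A) ⊃ A) ⊃ A, obtained from ax4, together with prelinearity.  A derivation from
-- hypotheses is then written out as an Ł3n∨ run: cut becomes concatenation, case splitting
-- becomes ∨ne, and a hypothesis is re-derived on top of the run in three lines.  Both stages
-- spend a bounded number of lines per step, which gives the linear bound.

module Submission where

open import Defs
open import Data.Nat using (ℕ; suc; _+_; _*_; _≤_)
open import Data.Nat.Properties
open import Data.Nat.Solver using (module +-*-Solver)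
open import Data.List using (List; []; _∷_)
open import Data.List.Membership.Propositional using (_∈_)
open import Data.List.Relation.Unary.Any using (here; there)
open import Data.List.Relation.Binary.Subset.Propositional using (_⊆_)
open import Data.List.Relation.Binary.Subset.Propositional.Properties using (⊆-refl; ⊆-trans; ∷⁺ʳ)
open import Data.Product using (Σ; _,_; proj₂)
open import Data.Unit using (tt)
open import Relation.Binary.PropositionalEquality using (_≡_; refl; cong; cong₂; sym; trans)

private variable
  Γ Δ Δ′ Δ″ Θ : List Fm
  A B C P Q : Fm

infix 4 _⊢_

data _⊢_ (Γ : List Fm) : Fm → Set where
  hyp     : A ∈ Γ → Γ ⊢ A
  ax      : HŁuk A → Γ ⊢ A
  mp      : Γ ⊢ A ⊃ B → Γ ⊢ A → Γ ⊢ B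
  cut     : Γ ⊢ A → A ∷ Γ ⊢ B → Γ ⊢ B
  ∨-cases : Γ ⊢ A ∨ B → A ∷ Γ ⊢ C → B ∷ Γ ⊢ C → Γ ⊢ C

-- Exactly the number of lines that linearise writes for the derivation.
cost : Γ ⊢ A → ℕ
cost (hyp _)         = 3
cost (ax _)          = 1
cost (mp p q)        = suc (cost p + cost q)
cost (cut p q)       = cost p + cost q
cost (∨-cases p q r) = suc (cost p + suc (cost q) + suc (cost r))

var₀ : A ∷ Γ ⊢ A
var₀ = hyp (here refl)

var₁ : B ∷ A ∷ Γ ⊢ A
var₁ = hyp (there (here refl))

var₂ : C ∷ B ∷ A ∷ Γ ⊢ A
var₂ = hyp (there (there (here refl)))

⊃-trans : Γ ⊢ A ⊃ B → Γ ⊢ B ⊃ C → Γ ⊢ A ⊃ C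
⊃-trans p q = mp (mp (ax (ax2 _ _ _)) p) q

⊃-suffix : Γ ⊢ A ⊃ B → Γ ⊢ (B ⊃ C) ⊃ (A ⊃ C)
⊃-suffix p = mp (ax (ax2 _ _ _)) p

⊃-assert : ∀ A B → Γ ⊢ A ⊃ (A ⊃ B) ⊃ B
⊃-assert A B = ⊃-trans (ax (ax1 A (B ⊃ A))) (ax (ax3 B A))

⊃-exchange : Γ ⊢ A ⊃ B ⊃ C → Γ ⊢ B ⊃ A ⊃ C
⊃-exchange {B = B} {C = C} p = ⊃-trans (⊃-assert B C) (⊃-suffix p)

⊃-prefix : Γ ⊢ B ⊃ C → Γ ⊢ (A ⊃ B) ⊃ (A ⊃ C)
⊃-prefix p = mp (⊃-exchange (ax (ax2 _ _ _))) p

⊃-∧ : Γ ⊢ A ⊃ B → Γ ⊢ A ⊃ C → Γ ⊢ A ⊃ B ∧ C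
⊃-∧ p q = mp (mp (ax (ax7 _ _ _)) p) q

∨-⊃ : Γ ⊢ A ⊃ C → Γ ⊢ B ⊃ C → Γ ⊢ A ∨ B ⊃ C
∨-⊃ p q = mp (mp (ax (ax10 _ _ _)) p) q

∧-intro : Γ ⊢ A → Γ ⊢ B → Γ ⊢ A ∧ B
∧-intro {A = A} p q = mp (⊃-∧ (mp (ax (ax1 A A)) p) (mp (ax (ax1 _ A)) q)) p

explosion : ∀ A B → Γ ⊢ ¬ A ⊃ A ⊃ B
explosion A B = ⊃-trans (ax (ax1 (¬ A) (¬ B))) (ax (ax11 A B))

¬¬-elim : ∀ A → Γ ⊢ ¬ ¬ A ⊃ A
¬¬-elim A = ⊃-trans (⊃-trans (explosion (¬ A) (¬ T)) (ax (ax11 T A))) (mp (⊃-assert _ A) (ax (ax1 A A)))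
  where T = A ⊃ A ⊃ A

¬¬-intro : ∀ A → Γ ⊢ A ⊃ ¬ ¬ A
¬¬-intro A = mp (ax (ax11 A (¬ ¬ A))) (¬¬-elim (¬ A))

contraposition-⊃ : ∀ A B → Γ ⊢ (A ⊃ B) ⊃ (¬ B ⊃ ¬ A)
contraposition-⊃ A B =
  ⊃-trans (⊃-trans (⊃-suffix (¬¬-elim A)) (⊃-prefix (¬¬-intro B))) (ax (ax11 (¬ B) (¬ A)))

contraposition : Γ ⊢ A ⊃ B → Γ ⊢ ¬ B ⊃ ¬ A
contraposition p = mp (contraposition-⊃ _ _) p

⊃⊃⇒∨ : Γ ⊢ (A ⊃ B) ⊃ B → Γ ⊢ A ∨ B
⊃⊃⇒∨ {A = A} {B = B} p =
  mp (mp (ax (ax3 (A ∨ B) B)) (⊃-trans (⊃-suffix (ax (ax8 A B))) p)) (ax (ax9 A B))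

peirce¬ : ∀ A → Γ ⊢ ((A ⊃ ¬ A) ⊃ A) ⊃ A
peirce¬ A = mp (ax (ax11 S A)) (mp (ax (ax4 A (¬ A) (¬ S))) (contraposition-⊃ S A))
  where S = (A ⊃ ¬ A) ⊃ A

self-refuting-∨ : ∀ A → Γ ⊢ (A ⊃ ¬ A) ∨ A
self-refuting-∨ A = ⊃⊃⇒∨ (peirce¬ A)

self-refuting-⊃-converse : ∀ A B → Γ ⊢ ((A ⊃ B) ⊃ ¬ (A ⊃ B)) ⊃ B ⊃ A
self-refuting-⊃-converse A B =
  ⊃-exchange (⊃-trans (ax (ax1 B A)) (⊃-trans (⊃-exchange ¬A⇒u⇒¬[u⊃¬u]) (ax (ax11 (u ⊃ ¬ u) A))))
  where
    u = A ⊃ B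
    u⇒u⇒¬[u⊃¬u] : Γ ⊢ u ⊃ u ⊃ ¬ (u ⊃ ¬ u)
    u⇒u⇒¬[u⊃¬u] = ⊃-trans (⊃-trans (⊃-assert u (¬ u)) (contraposition-⊃ (u ⊃ ¬ u) (¬ u))) (⊃-suffix (¬¬-intro u))
    ¬A⇒u⇒¬[u⊃¬u] : Γ ⊢ ¬ A ⊃ u ⊃ ¬ (u ⊃ ¬ u)
    ¬A⇒u⇒¬[u⊃¬u] = ⊃-trans (explosion A B) u⇒u⇒¬[u⊃¬u]

prelinearity : ∀ A B → Γ ⊢ (A ⊃ B) ∨ (B ⊃ A)
prelinearity A B = ∨-cases (self-refuting-∨ (A ⊃ B))
  (mp (ax (ax9 _ _)) (mp (self-refuting-⊃-converse A B) var₀))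
  (mp (ax (ax8 _ _)) var₀)

-- When A ⊃ ¬ A and ¬ B ⊃ ¬ ¬ B, either direction of prelinearity between A and ¬ B
-- yields A ⊃ B; the other cases give A ∨ ¬ A or B ∨ ¬ B directly.
nd-axiom : ∀ A B → Γ ⊢ (A ∨ ¬ A) ∨ ((B ∨ ¬ B) ∨ (A ⊃ B))
nd-axiom A B = ∨-cases (self-refuting-∨ A)
  (∨-cases (self-refuting-∨ (¬ B))
    (∨-cases (prelinearity A (¬ B))
      (third (⊃-trans var₀ ¬B⊃B))
      (third (⊃-trans (¬¬-intro A) (⊃-trans (contraposition (⊃-trans var₀ var₂)) (¬¬-elim B)))))
    (second (mp (ax (ax9 B (¬ B))) var₀)))
  (first (mp (ax (ax8 A (¬ A))) var₀))
  where
    first : Γ ⊢ A ∨ ¬ A → Γ ⊢ (A ∨ ¬ A) ∨ ((B ∨ ¬ B) ∨ (A ⊃ B))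
    first p = mp (ax (ax8 _ _)) p
    second : Γ ⊢ B ∨ ¬ B → Γ ⊢ (A ∨ ¬ A) ∨ ((B ∨ ¬ B) ∨ (A ⊃ B))
    second p = mp (ax (ax9 _ _)) (mp (ax (ax8 _ _)) p)
    third : Γ ⊢ A ⊃ B → Γ ⊢ (A ∨ ¬ A) ∨ ((B ∨ ¬ B) ∨ (A ⊃ B))
    third p = mp (ax (ax9 _ _)) (mp (ax (ax9 _ _)) p)
    ¬B⊃B : (A ⊃ ¬ B) ∷ (¬ B ⊃ ¬ ¬ B) ∷ Θ ⊢ ¬ B ⊃ B
    ¬B⊃B = ⊃-trans var₁ (¬¬-elim B)

¬∨⊃¬∧¬ : ∀ A B → Γ ⊢ ¬ (A ∨ B) ⊃ ¬ A ∧ ¬ B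
¬∨⊃¬∧¬ A B = ⊃-∧ (contraposition (ax (ax8 A B))) (contraposition (ax (ax9 A B)))

¬∧¬⊃¬∨ : ∀ A B → Γ ⊢ ¬ A ∧ ¬ B ⊃ ¬ (A ∨ B)
¬∧¬⊃¬∨ A B = ⊃-trans (¬¬-intro _) (contraposition ∨⊃¬[¬∧¬])
  where
    ∨⊃¬[¬∧¬] : Γ ⊢ A ∨ B ⊃ ¬ (¬ A ∧ ¬ B)
    ∨⊃¬[¬∧¬] = ∨-⊃ (⊃-trans (¬¬-intro A) (contraposition (ax (ax5 (¬ A) (¬ B)))))
                   (⊃-trans (¬¬-intro B) (contraposition (ax (ax6 (¬ A) (¬ B)))))

¬∧⊃¬∨¬ : ∀ A B → Γ ⊢ ¬ (A ∧ B) ⊃ ¬ A ∨ ¬ B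
¬∧⊃¬∨¬ A B = ⊃-trans (contraposition ¬[¬∨¬]⊃∧) (¬¬-elim _)
  where
    ¬[¬∨¬]⊃∧ : Γ ⊢ ¬ (¬ A ∨ ¬ B) ⊃ A ∧ B
    ¬[¬∨¬]⊃∧ = ⊃-∧ (⊃-trans (contraposition (ax (ax8 (¬ A) (¬ B)))) (¬¬-elim A))
                   (⊃-trans (contraposition (ax (ax9 (¬ A) (¬ B)))) (¬¬-elim B))

¬∨¬⊃¬∧ : ∀ A B → Γ ⊢ ¬ A ∨ ¬ B ⊃ ¬ (A ∧ B)
¬∨¬⊃¬∧ A B = ∨-⊃ (contraposition (ax (ax5 A B))) (contraposition (ax (ax6 A B)))

translate : Γ ⊆ Δ → ND Γ C → Δ ⊢ C

rule₁ : Γ ⊆ Δ → ND Γ P → (∀ {Θ} → P ∷ Θ ⊢ C) → Δ ⊢ C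
rule₁ f p r = cut (translate f p) r

rule₂ : Γ ⊆ Δ → ND Γ P → ND Γ Q → (∀ {Θ} → Q ∷ P ∷ Θ ⊢ C) → Δ ⊢ C
rule₂ f p q r = cut (translate f p) (cut (translate (λ m → there (f m)) q) r)

translate f (hyp m)            = hyp (f m)
translate f (axm A B)          = nd-axiom A B
translate f (efq {A} B p q)    = rule₂ f p q (mp (mp (explosion A B) var₀) var₁)
translate f (∧I p q)           = rule₂ f p q (∧-intro var₁ var₀)
translate f (∧E₁ p)            = rule₁ f p (mp (ax (ax5 _ _)) var₀)
translate f (∧E₂ p)            = rule₁ f p (mp (ax (ax6 _ _)) var₀)
translate f (∨I₁ B p)          = rule₁ f p (mp (ax (ax8 _ B)) var₀)
translate f (∨I₂ A p)          = rule₁ f p (mp (ax (ax9 A _)) var₀)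
translate f (∨E p q r)         = ∨-cases (translate f p) (translate (∷⁺ʳ _ f) q) (translate (∷⁺ʳ _ f) r)
translate f (dnI {A} p)        = rule₁ f p (mp (¬¬-intro A) var₀)
translate f (dnE {A} p)        = rule₁ f p (mp (¬¬-elim A) var₀)
translate f (deM∨₁ {A} {B} p)  = rule₁ f p (mp (¬∨⊃¬∧¬ A B) var₀)
translate f (deM∨₂ {A} {B} p)  = rule₁ f p (mp (¬∧¬⊃¬∨ A B) var₀)
translate f (deM∧₁ {A} {B} p)  = rule₁ f p (mp (¬∧⊃¬∨¬ A B) var₀)
translate f (deM∧₂ {A} {B} p)  = rule₁ f p (mp (¬∨¬⊃¬∧ A B) var₀)
translate f (⊃₁ {A} {B} p)     = rule₁ f p (mp (explosion A B) (mp (ax (ax5 _ _)) var₀))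
translate f (⊃₂ {A} B p)       = rule₁ f p (mp (ax (ax9 _ _)) (mp (explosion A B) var₀))
translate f (⊃₃ {A} {B} p)     = rule₁ f p (mp (ax (ax1 B A)) (mp (ax (ax6 _ _)) var₀))
translate f (⊃₄ {A} {B} p q)   = rule₂ f p q (∨-cases var₀
  (mp (ax (ax9 A (¬ A))) (mp (contraposition var₀) var₂))
  (mp (ax (ax8 A (¬ A))) (mp (¬¬-elim A) (mp (contraposition (explosion A B)) var₀))))
translate f (⊃₅ A {B} p)       = rule₁ f p (mp (ax (ax9 _ _)) (mp (ax (ax1 B A)) var₀))
translate f (⊃₆ {A} {B} p)     =
  rule₁ f p (mp (contraposition (mp (⊃-assert A B) (mp (ax (ax5 _ _)) var₀))) (mp (ax (ax6 A (¬ B))) var₀))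
translate f (⊃₇ {A} {B} p q)   = rule₂ f p q (∨-cases var₀
  (mp (ax (ax8 B (¬ B))) (mp var₀ var₂))
  (mp (ax (ax9 B (¬ B))) (mp (contraposition (ax (ax1 B A))) var₀)))
translate f (⊃₈ {A} {B} p)     = rule₁ f p (mp (ax (ax1 B A)) (mp (ax (ax6 _ _)) var₀))

module CostArithmetic (K : ℕ) where
  open +-*-Solver

  unary-bound : ∀ x {a k} → a ≤ x * K → k ≤ K → a + k ≤ suc x * K
  unary-bound x {a} {k} a≤ k≤ = ≤-trans (≤-reflexive (+-comm a k)) (+-mono-≤ k≤ a≤)

  binary-bound : ∀ x y {a b k} → a ≤ x * K → b ≤ y * K → k ≤ K → a + (b + k) ≤ suc (x + y) * K
  binary-bound x y a≤ b≤ k≤ = ≤-trans (+-mono-≤ a≤ (+-mono-≤ b≤ k≤))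
    (≤-reflexive (solve 3 (λ K x y → x :* K :+ (y :* K :+ K) := (con 1 :+ (x :+ y)) :* K) refl K x y))

  cases-bound : ∀ x y z {a b c} → a ≤ x * K → b ≤ y * K → c ≤ z * K → 3 ≤ K →
                suc (a + suc b + suc c) ≤ suc (x + y + z) * K
  cases-bound x y z {a} {b} {c} a≤ b≤ c≤ 3≤ = ≤-trans
    (≤-reflexive (solve 3 (λ a b c → con 1 :+ (a :+ (con 1 :+ b) :+ (con 1 :+ c)) := a :+ b :+ c :+ con 3) refl a b c))
    (≤-trans (+-mono-≤ (+-mono-≤ (+-mono-≤ a≤ b≤) c≤) 3≤)
      (≤-reflexive (solve 4 (λ K x y z → x :* K :+ y :* K :+ z :* K :+ K := (con 1 :+ (x :+ y :+ z)) :* K) refl K x y z)))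

-- The cost of nd-axiom, the most expensive rule.
K : ℕ
K = 551

open CostArithmetic K

translate-cost : (f : Γ ⊆ Δ) (p : ND Γ C) → cost (translate f p) ≤ ndSize p * K
translate-cost f (hyp m)     = ≤ᵇ⇒≤ _ _ tt
translate-cost f (axm A B)   = ≤ᵇ⇒≤ _ _ tt
translate-cost f (efq B p q) = binary-bound (ndSize p) (ndSize q) (translate-cost f p) (translate-cost _ q) (≤ᵇ⇒≤ _ _ tt)
translate-cost f (∧I p q)    = binary-bound (ndSize p) (ndSize q) (translate-cost f p) (translate-cost _ q) (≤ᵇ⇒≤ _ _ tt)
translate-cost f (∧E₁ p)     = unary-bound (ndSize p) (translate-cost f p) (≤ᵇ⇒≤ _ _ tt)
translate-cost f (∧E₂ p)     = unary-bound (ndSize p) (translate-cost f p) (≤ᵇ⇒≤ _ _ tt)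
translate-cost f (∨I₁ B p)   = unary-bound (ndSize p) (translate-cost f p) (≤ᵇ⇒≤ _ _ tt)
translate-cost f (∨I₂ A p)   = unary-bound (ndSize p) (translate-cost f p) (≤ᵇ⇒≤ _ _ tt)
translate-cost f (∨E p q r)  =
  cases-bound (ndSize p) (ndSize q) (ndSize r) (translate-cost f p) (translate-cost _ q) (translate-cost _ r) (≤ᵇ⇒≤ _ _ tt)
translate-cost f (dnI p)     = unary-bound (ndSize p) (translate-cost f p) (≤ᵇ⇒≤ _ _ tt)
translate-cost f (dnE p)     = unary-bound (ndSize p) (translate-cost f p) (≤ᵇ⇒≤ _ _ tt)
translate-cost f (deM∨₁ p)   = unary-bound (ndSize p) (translate-cost f p) (≤ᵇ⇒≤ _ _ tt)
translate-cost f (deM∨₂ p)   = unary-bound (ndSize p) (translate-cost f p) (≤ᵇ⇒≤ _ _ tt)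
translate-cost f (deM∧₁ p)   = unary-bound (ndSize p) (translate-cost f p) (≤ᵇ⇒≤ _ _ tt)
translate-cost f (deM∧₂ p)   = unary-bound (ndSize p) (translate-cost f p) (≤ᵇ⇒≤ _ _ tt)
translate-cost f (⊃₁ p)      = unary-bound (ndSize p) (translate-cost f p) (≤ᵇ⇒≤ _ _ tt)
translate-cost f (⊃₂ B p)    = unary-bound (ndSize p) (translate-cost f p) (≤ᵇ⇒≤ _ _ tt)
translate-cost f (⊃₃ p)      = unary-bound (ndSize p) (translate-cost f p) (≤ᵇ⇒≤ _ _ tt)
translate-cost f (⊃₄ p q)    = binary-bound (ndSize p) (ndSize q) (translate-cost f p) (translate-cost _ q) (≤ᵇ⇒≤ _ _ tt)
translate-cost f (⊃₅ A p)    = unary-bound (ndSize p) (translate-cost f p) (≤ᵇ⇒≤ _ _ tt)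
translate-cost f (⊃₆ p)      = unary-bound (ndSize p) (translate-cost f p) (≤ᵇ⇒≤ _ _ tt)
translate-cost f (⊃₇ p q)    = binary-bound (ndSize p) (ndSize q) (translate-cost f p) (translate-cost _ q) (≤ᵇ⇒≤ _ _ tt)
translate-cost f (⊃₈ p)      = unary-bound (ndSize p) (translate-cost f p) (≤ᵇ⇒≤ _ _ tt)

_++ᴸ_ : Lines Δ Δ′ → Lines Δ′ Δ″ → Lines Δ Δ″
r ++ᴸ start           = r
r ++ᴸ axL s a         = axL (r ++ᴸ s) a
r ++ᴸ mpL s m n       = mpL (r ++ᴸ s) m n
r ++ᴸ ∨neL s m b₁ b₂  = ∨neL (r ++ᴸ s) m b₁ b₂

lines#-++ : (r : Lines Δ Δ′) (s : Lines Δ′ Δ″) → lines# (r ++ᴸ s) ≡ lines# r + lines# s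
lines#-++ r start              = sym (+-identityʳ (lines# r))
lines#-++ r (axL s _)          = trans (cong suc (lines#-++ r s)) (sym (+-suc (lines# r) (lines# s)))
lines#-++ r (mpL s _ _)        = trans (cong suc (lines#-++ r s)) (sym (+-suc (lines# r) (lines# s)))
lines#-++ r (∨neL s _ b₁ b₂)   = trans (cong (λ n → suc (n + suc (lines# b₁) + suc (lines# b₂))) (lines#-++ r s))
  (solve 4 (λ r s b₁ b₂ → con 1 :+ (r :+ s :+ b₁ :+ b₂) := r :+ (con 1 :+ (s :+ b₁ :+ b₂))) refl
     (lines# r) (lines# s) (suc (lines# b₁)) (suc (lines# b₂)))
  where open +-*-Solver

record Linearisation (Δ : List Fm) (A : Fm) (n : ℕ) : Set where
  field
    {rest} : List Fm
    run    : Lines Δ (A ∷ rest)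
    keeps  : Δ ⊆ rest
    length : lines# run ≡ n

rederive : A ∈ Δ → Lines Δ (A ∷ (A ⊃ A) ∷ (A ⊃ A ⊃ A) ∷ Δ)
rederive {A = A} m = mpL (mpL (axL start (ax1 A A)) (there m) (here refl)) (there (there m)) (here refl)

linearise : Γ ⊆ Δ → (p : Γ ⊢ A) → Linearisation Δ A (cost p)
linearise f (hyp m) = record { run = rederive (f m) ; keeps = λ m → there (there m) ; length = refl }
linearise f (ax a)  = record { run = axL start a ; keeps = ⊆-refl ; length = refl }
linearise f (mp p q) = record
  { run    = mpL (L₁.run ++ᴸ L₂.run) (here refl) (there (L₂.keeps (here refl)))
  ; keeps  = λ m → there (L₂.keeps (there (L₁.keeps m)))
  ; length = cong suc (trans (lines#-++ L₁.run L₂.run) (cong₂ _+_ L₁.length L₂.length))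
  }
  where
    module L₁ = Linearisation (linearise f p)
    module L₂ = Linearisation (linearise (λ m → there (L₁.keeps (f m))) q)
linearise f (cut p q) = record
  { run    = L₁.run ++ᴸ L₂.run
  ; keeps  = λ m → L₂.keeps (there (L₁.keeps m))
  ; length = trans (lines#-++ L₁.run L₂.run) (cong₂ _+_ L₁.length L₂.length)
  }
  where
    module L₁ = Linearisation (linearise f p)
    module L₂ = Linearisation (linearise (∷⁺ʳ _ (⊆-trans f L₁.keeps)) q)
linearise f (∨-cases p q r) = record
  { run    = ∨neL L₀.run (here refl) L₁.run L₂.run
  ; keeps  = λ m → there (L₀.keeps m)
  ; length = cong suc (cong₂ _+_ (cong₂ _+_ L₀.length (cong suc L₁.length)) (cong suc L₂.length))
  }
  where
    module L₀ = Linearisation (linearise f p)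
    module L₁ = Linearisation (linearise (∷⁺ʳ _ (λ m → there (L₀.keeps (f m)))) q)
    module L₂ = Linearisation (linearise (∷⁺ʳ _ (λ m → there (L₀.keeps (f m)))) r)

theorem11 : Σ ℕ (λ c → ∀ (D : Fm) (p : NDProof D) →
                Σ (ŁProof D) (λ q → lines# (proj₂ q) ≤ c * ndSize p))
theorem11 = K , λ D p →
  let derivation = translate {Δ = []} (λ ()) p
      open Linearisation (linearise (λ ()) derivation)
  in (rest , run) , (begin
       lines# run        ≡⟨ length ⟩
       cost derivation   ≤⟨ translate-cost (λ ()) p ⟩
       ndSize p * K      ≡⟨ *-comm (ndSize p) K ⟩
       K * ndSize p      ∎)
  where open ≤-Reasoning
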